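{- Let $n, r, d$ be positive integers with $n\geqslant r+1$ and $d\geqslant 2$. Then $\mathcal{A}_r^d$ is a percolating set of $K_n^d$ in the $r$-neighbor bootstrap percolation process.
   Context: All graphs are finite, simple and undirected. For an integer $r\geqslant 0$ and a graph $G$, the $r$-neighbor bootstrap percolation process on $G$ starts with a set $A_0\subseteq V(G)$ of initially active vertices, and for $i\geqslant 1$, $A_i=A_{i-1}\cup\{v\in V(G): |N(v)\cap A_{i-1}|\geqslant r\}$, where $N(v)$ is the set of neighbors of $v$; $A_0$ is a percolating set if $\bigcup_{i\geqslant 0}A_i=V(G)$. $K_n^d$ is the Cartesian product of $d$ copies of $K_n$: vertex set $[\![n]\!]^d$ where $[\![n]\!]=\{0,1,\ldots,n-1\}$, two vertices adjacent iff they differ in exactly one coordinate. For $t=(t_1,\ldots,t_d)\in\{0,1\}^d$ and $P\subseteq[\![n]\!]^d$, let $P(t)$ be the set of $(x_1,\ldots,x_d)\in[\![n]\!]^d$ for which there exists $(p_1,\ldots,p_d)\in P$ with $x_i=t_i(n-1-p_i)+(1-t_i)p_i$ for all $i$. Let $A_r^d=\{(x_1,\ldots,x_d)\in[\![n]\!]^d : \sum_{i=1}^d x_i\leqslant\lceil r/2\rceil-1\}$, let $T=\{(t_1,\ldots,t_d)\in\{0,1\}^d : t_1=t_2\}$, and $\mathcal{A}_r^d=\bigcup_{t\in T}A_r^d(t)$. -}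

module Defs where

open import Data.Bool using (Bool; true; false; _∧_; _∨_; if_then_else_)
open import Data.Nat using (ℕ; zero; suc; _+_; _*_; _∸_; _≤ᵇ_; _≡ᵇ_; ⌈_/2⌉)
open import Data.Fin using (Fin; toℕ; _≟_)
import Data.Fin as Fin
open import Data.List using (List; []; _∷_; concatMap; map; filter; length; allFin)
open import Data.Bool.ListAction using (any; all)
open import Data.Nat.ListAction using (sum)
open import Data.Vec.Functional using (Vector)
import Data.Vec.Functional as VF
open import Relation.Nullary.Decidable using (⌊_⌋; ¬?)

Vertex : ℕ → ℕ → Set
Vertex n d = Vector (Fin n) d

allVectors : {A : Set} → List A → (d : ℕ) → List (Vector A d)
allVectors xs zero = (λ ()) ∷ []
allVectors xs (suc d) = concatMap (λ a → map (λ w → a VF.∷ w) (allVectors xs d)) xs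

vertices : (n d : ℕ) → List (Vertex n d)
vertices n d = allVectors (allFin n) d

hamming : {n d : ℕ} → Vertex n d → Vertex n d → ℕ
hamming {n} {d} u v = length (filter (λ i → ¬? (u i ≟ v i)) (allFin d))

adj : {n d : ℕ} → Vertex n d → Vertex n d → Bool
adj u v = hamming u v ≡ᵇ 1

VSet : ℕ → ℕ → Set
VSet n d = Vertex n d → Bool

nbrCount : {n d : ℕ} → VSet n d → Vertex n d → ℕ
nbrCount {n} {d} A v = length (Data.List.filter (λ u → Data.Bool._≟_ (adj v u ∧ A u) true) (vertices n d))

step : {n d : ℕ} → ℕ → VSet n d → VSet n d
step r A v = A v ∨ (r ≤ᵇ nbrCount A v)

active : {n d : ℕ} → ℕ → VSet n d → ℕ → VSet n d
active r A0 zero = A0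
active r A0 (suc i) = step r (active r A0 i)

Percolates : (n d r : ℕ) → VSet n d → Set
Percolates n d r A0 = (v : Vertex n d) → Data.Product.∃ λ i → active r A0 i v ≡ true
  where open import Data.Product
        open import Relation.Binary.PropositionalEquality using (_≡_)

coordSum : {n d : ℕ} → Vertex n d → ℕ
coordSum {n} {d} x = sum (map (λ i → toℕ (x i)) (allFin d))

Ard : (n d r : ℕ) → VSet n d
Ard n d r x = coordSum x ≤ᵇ (⌈ r /2⌉ ∸ 1)

-- t ∈ {0,1}^d encoded as Bool (true = 1); x is the t-reflection of p:
-- x_i = t_i (n-1-p_i) + (1-t_i) p_i  for all i
reflects : {n d : ℕ} → Vector Bool d → Vertex n d → Vertex n d → Bool
reflects {n} {d} t p x =
  all (λ i → toℕ (x i) ≡ᵇ (if t i then n ∸ 1 ∸ toℕ (p i) else toℕ (p i))) (allFin d)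

reflectSet : {n d : ℕ} → Vector Bool d → VSet n d → VSet n d
reflectSet {n} {d} t P x = any (λ p → P p ∧ reflects t p x) (vertices n d)

-- T = { t ∈ {0,1}^d : t_1 = t_2 } (coordinates 1,2 are Fin indices 0,1; only used for d ≥ 2)
inT : {d : ℕ} → Vector Bool d → Bool
inT {suc (suc d)} t = ⌊ Data.Bool._≟_ (t Fin.zero) (t (Fin.suc Fin.zero)) ⌋
inT {_} t = false

calA : (n d r : ℕ) → VSet n d
calA n d r x = any (λ t → inT t ∧ reflectSet t (Ard n d r) x) (allVectors (true ∷ false ∷ []) d)

module Submission where

-- Write n = N + 1, K = ⌈r/2⌉ and depth(z) = min(z, N - z) for a coordinate z.
-- A vertex v = (x, y, w) with w ∈ [[n]]^(d-2) gets the potential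
--     μ(v) = (N - x) + y + Σ_j depth(w_j),
-- and we show by strong induction on μ(v) that v is active at time μ(v) + 1.
-- It suffices that v has r neighbours which have smaller potential or lie in 𝒜:
--   * moving some w_j to a shallower value lowers μ; each such line offers
--     2·depth(w_j) of them (nbrCount-depthSum);
--   * on the x-line the values above x lower μ, and the values c with
--     c + y + Σ depth(w_j) < K give points of A_r^d;
--   * on the y-line the values below y lower μ, and the values c with
--     (N - x) + (N - c) + Σ depth(w_j) < K give points of A_r^d(1,1,…).
-- Adding up, with r ≤ N and r ≤ 2K, gives r neighbours (enoughNeighbours).

open import Data.Bool using (Bool; true; false; _∧_; _∨_; not; if_then_else_; T)
import Data.Bool as Bool
open import Data.Bool.Properties using (∨-zeroʳ; T-≡)
open import Data.Bool.ListAction using (any; all; or; and)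
open import Data.Empty using (⊥-elim)
open import Data.Fin using (Fin; toℕ; opposite) renaming (zero to 0F; suc to sucF)
import Data.Fin as Fin
open import Data.Fin.Properties using (toℕ≤pred[n]; opposite-prop)
open import Data.List using (List; []; _∷_; _++_; map; filter; length; concatMap; concat; tabulate; allFin)
open import Data.List.Membership.Propositional using (_∈_)
open import Data.List.Membership.Propositional.Properties using (∈-map⁺; ∈-tabulate⁺; ∈-concatMap⁺)
open import Data.List.Properties using (map-tabulate; map-cong; tabulate-cong)
open import Data.List.Relation.Unary.Any using (here; there)
import Data.List.Relation.Unary.Any as Any
open import Data.Nat using (ℕ; zero; suc; _+_; _∸_; _≤_; _<_; _⊓_; z≤n; s≤s; s≤s⁻¹; ≤′-refl; ≤′-step; _≤ᵇ_; _<ᵇ_; _≡ᵇ_; ⌈_/2⌉; ⌊_/2⌋; _≤?_)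
open import Data.Nat.ListAction using (sum)
open import Data.Nat.Properties
open import Data.Nat.Solver using (module +-*-Solver)
open import Data.Product using (Σ; _,_; _×_)
open import Data.Sum using (_⊎_; inj₁; inj₂)
open import Data.Vec.Functional using (Vector; tail) renaming (_∷_ to _◂_)
open import Function using (_∘_; id)
open import Function.Bundles using (Equivalence)
open import Relation.Binary.PropositionalEquality
open import Relation.Nullary using (yes; no; does)
open import Relation.Nullary.Decidable using (¬?; fromWitness)
open import Relation.Unary using (Pred; Decidable)
open import Level using (0ℓ)

open import Defs

open +-*-Solver using (solve; _:+_; _:=_)

T⇒≡true : {b : Bool} → T b → b ≡ true
T⇒≡true = Equivalence.to T-≡

≡true⇒T : {b : Bool} → b ≡ true → T b
≡true⇒T = Equivalence.from T-≡

∨-true : (a b : Bool) → (a ∨ b) ≡ true → a ≡ true ⊎ b ≡ true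
∨-true true  b _ = inj₁ refl
∨-true false b e = inj₂ e

∧-true : {a b : Bool} → a ≡ true → b ≡ true → (a ∧ b) ≡ true
∧-true refl refl = refl

-- Counting entries of a list that pass a Boolean test.  This is the
-- form in which nbrCount is defined, so nbrCount A v is definitionally
-- count (λ u → adj v u ∧ A u) (vertices n d).

count : {A : Set} → (A → Bool) → List A → ℕ
count f xs = length (filter (λ x → f x Bool.≟ true) xs)

module _ {A : Set} where

  count-∷ : (f : A → Bool) (x : A) (xs : List A) →
    count f (x ∷ xs) ≡ (if f x then suc (count f xs) else count f xs)
  count-∷ f x xs with f x
  ... | true  = refl
  ... | false = refl

  count-++ : (f : A → Bool) (xs ys : List A) → count f (xs ++ ys) ≡ count f xs + count f ys
  count-++ f []       ys = refl
  count-++ f (x ∷ xs) ys rewrite count-∷ f x (xs ++ ys) | count-∷ f x xs with f x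
  ... | true  = cong suc (count-++ f xs ys)
  ... | false = count-++ f xs ys

  count-mono : (f g : A → Bool) → (∀ x → f x ≡ true → g x ≡ true) → ∀ xs → count f xs ≤ count g xs
  count-mono f g f⇒g [] = z≤n
  count-mono f g f⇒g (x ∷ xs) rewrite count-∷ f x xs | count-∷ g x xs with f x in fx | g x in gx
  ... | true  | true  = s≤s (count-mono f g f⇒g xs)
  ... | true  | false with () ← trans (sym (f⇒g x fx)) gx
  ... | false | true  = m≤n⇒m≤1+n (count-mono f g f⇒g xs)
  ... | false | false = count-mono f g f⇒g xs

  count-cong : (f g : A → Bool) → (∀ x → f x ≡ g x) → ∀ xs → count f xs ≡ count g xs
  count-cong f g f≗g xs = ≤-antisym (count-mono f g (λ x e → trans (sym (f≗g x)) e) xs)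
                                     (count-mono g f (λ x e → trans (f≗g x) e) xs)

  count-∈ : (f : A → Bool) {x : A} {xs : List A} → x ∈ xs → f x ≡ true → 1 ≤ count f xs
  count-∈ f {x} {_ ∷ xs} (here refl) fx rewrite count-∷ f x xs | fx = s≤s z≤n
  count-∈ f {x} {y ∷ xs} (there x∈xs) fx rewrite count-∷ f y xs with f y
  ... | true  = s≤s z≤n
  ... | false = count-∈ f x∈xs fx

  length-filter≡count : {P : Pred A 0ℓ} (P? : Decidable P) (xs : List A) →
    length (filter P? xs) ≡ count (does ∘ P?) xs
  length-filter≡count P? [] = refl
  length-filter≡count P? (x ∷ xs) with does (P? x)
  ... | true  = cong suc (length-filter≡count P? xs)
  ... | false = length-filter≡count P? xs

  count≤sum : (F : A → ℕ) (b : A → Bool) → (∀ a → b a ≡ true → 1 ≤ F a) →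
    ∀ xs → count b xs ≤ sum (map F xs)
  count≤sum F b pos [] = z≤n
  count≤sum F b pos (x ∷ xs) rewrite count-∷ b x xs with b x in bx
  ... | true  = +-mono-≤ (pos x bx) (count≤sum F b pos xs)
  ... | false = ≤-trans (count≤sum F b pos xs) (m≤n+m _ (F x))

  point+count≤sum : (F : A → ℕ) (b : A → Bool) (x₀ : A) → b x₀ ≡ false →
    (∀ a → b a ≡ true → 1 ≤ F a) → ∀ {xs} → x₀ ∈ xs → F x₀ + count b xs ≤ sum (map F xs)
  point+count≤sum F b x₀ bx₀ pos {_ ∷ xs} (here refl) rewrite count-∷ b x₀ xs | bx₀ =
    +-monoʳ-≤ (F x₀) (count≤sum F b pos xs)
  point+count≤sum F b x₀ bx₀ pos {y ∷ xs} (there x₀∈xs) rewrite count-∷ b y xs with b y in by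
  ... | true  = begin
    F x₀ + suc (count b xs) ≡⟨ +-suc (F x₀) (count b xs) ⟩
    1 + (F x₀ + count b xs) ≤⟨ +-mono-≤ (pos y by) (point+count≤sum F b x₀ bx₀ pos x₀∈xs) ⟩
    F y + sum (map F xs)    ∎
    where open ≤-Reasoning
  ... | false = ≤-trans (point+count≤sum F b x₀ bx₀ pos x₀∈xs) (m≤n+m _ (F y))

module _ {A C : Set} where

  count-map : (f : C → Bool) (g : A → C) (xs : List A) → count f (map g xs) ≡ count (f ∘ g) xs
  count-map f g [] = refl
  count-map f g (x ∷ xs) rewrite count-∷ f (g x) (map g xs) | count-∷ (f ∘ g) x xs with f (g x)
  ... | true  = cong suc (count-map f g xs)
  ... | false = count-map f g xs

  count-concatMap : (f : C → Bool) (h : A → List C) (xs : List A) →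
    count f (concatMap h xs) ≡ sum (map (count f ∘ h) xs)
  count-concatMap f h [] = refl
  count-concatMap f h (x ∷ xs) =
    trans (count-++ f (h x) (concat (map h xs))) (cong (count f (h x) +_) (count-concatMap f h xs))

count-tabulate : {A : Set} {n : ℕ} (f : A → Bool) (g : Fin n → A) →
  count f (tabulate g) ≡ count (f ∘ g) (allFin n)
count-tabulate {n = n} f g =
  trans (cong (count f) (sym (map-tabulate {n = n} id g))) (count-map f g (allFin n))

count-allFin-suc : {n : ℕ} (g : Fin (suc n) → Bool) →
  count g (allFin (suc n)) ≡ (if g 0F then suc (count (g ∘ sucF) (allFin n)) else count (g ∘ sucF) (allFin n))
count-allFin-suc {n} g rewrite count-∷ g 0F (tabulate sucF) | count-tabulate g (sucF {n}) = refl

-- Enumerations.  Vertices are functions, so membership in a list of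
-- vertices can only be established up to pointwise equality.

_≐_ : {A : Set} {d : ℕ} → Vector A d → Vector A d → Set
u ≐ v = ∀ i → u i ≡ v i

∈-allFin : {n : ℕ} (a : Fin n) → a ∈ allFin n
∈-allFin = ∈-tabulate⁺ {f = id}

allVectors-complete : {A : Set} (xs : List A) → (∀ a → a ∈ xs) → ∀ d (v : Vector A d) →
  Σ (Vector A d) λ w → w ∈ allVectors xs d × w ≐ v
allVectors-complete xs complete zero    v = (λ ()) , here refl , λ ()
allVectors-complete xs complete (suc d) v with allVectors-complete xs complete d (tail v)
... | w , w∈ , w≐ =
  (v 0F ◂ w) ,
  ∈-concatMap⁺ (λ a → map (a ◂_) (allVectors xs d)) (Any.map (λ { refl → ∈-map⁺ (v 0F ◂_) w∈ }) (complete (v 0F))) ,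
  λ { 0F → refl ; (sucF i) → w≐ i }

vertices-complete : {n d : ℕ} (v : Vertex n d) → Σ (Vertex n d) λ w → w ∈ vertices n d × w ≐ v
vertices-complete {n} {d} = allVectors-complete (allFin n) ∈-allFin d

Extensional : {n d : ℕ} → VSet n d → Set
Extensional {n} {d} B = ∀ u v → u ≐ v → B u ≡ B v

slice : {n d : ℕ} → VSet n (suc d) → Fin n → VSet n d
slice B a w = B (a ◂ w)

slice-extensional : {n d : ℕ} (B : VSet n (suc d)) → Extensional B → ∀ a → Extensional (slice B a)
slice-extensional B B-ext a u v u≐v = B-ext (a ◂ u) (a ◂ v) λ { 0F → refl ; (sucF i) → u≐v i }

differs : {n : ℕ} → Fin n → Fin n → Bool
differs a b = not (does (a Fin.≟ b))

differs-self : {n : ℕ} (a : Fin n) → differs a a ≡ false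
differs-self a with a Fin.≟ a
... | yes _ = refl
... | no a≢a = ⊥-elim (a≢a refl)

differs-≢ : {n : ℕ} (a b : Fin n) → toℕ a ≢ toℕ b → differs a b ≡ true
differs-≢ a b a≢b with a Fin.≟ b
... | yes a≡b = ⊥-elim (a≢b (cong toℕ a≡b))
... | no _    = refl

hamming-∷ : {n d : ℕ} (u v : Vertex n (suc d)) →
  hamming u v ≡ (if differs (u 0F) (v 0F) then suc (hamming (tail u) (tail v)) else hamming (tail u) (tail v))
hamming-∷ {n} {d} u v =
  trans (length-filter≡count (λ i → ¬? (u i Fin.≟ v i)) (allFin (suc d)))
        (trans (count-allFin-suc (λ i → differs (u i) (v i)))
               (cong (λ h → if differs (u 0F) (v 0F) then suc h else h)
                     (sym (length-filter≡count (λ i → ¬? (tail u i Fin.≟ tail v i)) (allFin d)))))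

hamming-≐ : {n d : ℕ} (u v : Vertex n d) → u ≐ v → hamming u v ≡ 0
hamming-≐ {d = zero}  u v u≐v = refl
hamming-≐ {d = suc d} u v u≐v
  rewrite hamming-∷ u v | hamming-≐ (tail u) (tail v) (u≐v ∘ sucF) | u≐v 0F | differs-self (v 0F) = refl

adj-sameHead : {n d : ℕ} (v : Vertex n (suc d)) (w : Vertex n d) → adj v (v 0F ◂ w) ≡ adj (tail v) w
adj-sameHead v w rewrite hamming-∷ v (v 0F ◂ w) | differs-self (v 0F) = refl

adj-otherHead : {n d : ℕ} (v : Vertex n (suc d)) (a : Fin n) (w : Vertex n d) →
  differs a (v 0F) ≡ true → tail v ≐ w → adj v (a ◂ w) ≡ true
adj-otherHead v a w a≠v₀ tail≐w rewrite hamming-∷ v (a ◂ w) | hamming-≐ (tail v) w tail≐w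
  with v 0F Fin.≟ a
... | yes refl rewrite differs-self a with () ← a≠v₀
... | no _ = refl

lineCount : {n d : ℕ} (B : VSet n (suc d)) (v : Vertex n (suc d)) → ℕ
lineCount {n} B v = count (λ a → differs a (v 0F) ∧ B (a ◂ tail v)) (allFin n)

nbrCount-split : {n d : ℕ} (B : VSet n (suc d)) → Extensional B → (v : Vertex n (suc d)) →
  nbrCount (slice B (v 0F)) (tail v) + lineCount B v ≤ nbrCount B v
nbrCount-split {n} {d} B B-ext v = begin
  nbrCount (slice B (v 0F)) (tail v) + lineCount B v ≡⟨ cong (_+ lineCount B v) (sym sliceCount) ⟩
  F (v 0F) + lineCount B v                           ≤⟨ point+count≤sum F b (v 0F) b-v₀ b⇒F (∈-allFin (v 0F)) ⟩
  sum (map F (allFin n))                             ≡⟨ sym (count-concatMap P (λ a → map (a ◂_) vs) (allFin n)) ⟩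
  nbrCount B v                                       ∎
  where
    open ≤-Reasoning
    vs = allVectors (allFin n) d
    P : Vertex n (suc d) → Bool
    P u = adj v u ∧ B u
    F : Fin n → ℕ
    F a = count P (map (a ◂_) vs)
    b : Fin n → Bool
    b a = differs a (v 0F) ∧ B (a ◂ tail v)
    b-v₀ : b (v 0F) ≡ false
    b-v₀ rewrite differs-self (v 0F) = refl
    sliceCount : F (v 0F) ≡ nbrCount (slice B (v 0F)) (tail v)
    sliceCount = trans (count-map P (v 0F ◂_) vs)
                       (count-cong _ _ (λ w → cong (_∧ B (v 0F ◂ w)) (adj-sameHead v w)) vs)
    b⇒F : ∀ a → b a ≡ true → 1 ≤ F a
    b⇒F a ba with differs a (v 0F) in a≠v₀ | vertices-complete (tail v)
    ... | false | _ with () ← ba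
    ... | true | w , w∈ , w≐ = count-∈ P (∈-map⁺ (a ◂_) w∈) (∧-true
          (adj-otherHead v a w a≠v₀ (sym ∘ w≐))
          (trans (B-ext (a ◂ w) (a ◂ tail v) λ { 0F → refl ; (sucF i) → w≐ i }) ba))

count-allFin-head : {n : ℕ} (g : Fin (suc n) → Bool) → g 0F ≡ true →
  suc (count (g ∘ sucF) (allFin n)) ≤ count g (allFin (suc n))
count-allFin-head g g₀ rewrite count-allFin-suc g | g₀ = ≤-refl

count-allFin-tail : {n : ℕ} (g : Fin (suc n) → Bool) →
  count (g ∘ sucF) (allFin n) ≤ count g (allFin (suc n))
count-allFin-tail g rewrite count-allFin-suc g with g 0F
... | true  = n≤1+n _
... | false = ≤-refl

-- Induction on n, removing the first value: it is counted when it belongs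
-- to the prefix (m₁ > 0) or when the suffix is the whole line (m₂ = n).
prefix+suffix≤count : ∀ n (g : Fin n → Bool) m₁ m₂ → m₁ + m₂ ≤ n →
  (∀ c → toℕ c < m₁ → g c ≡ true) → (∀ c → n ≤ toℕ c + m₂ → g c ≡ true) →
  m₁ + m₂ ≤ count g (allFin n)
prefix+suffix≤count zero    g m₁ m₂ le _ _ = le
prefix+suffix≤count (suc n) g (suc m₁) m₂ le pre suf =
  ≤-trans (s≤s (prefix+suffix≤count n (g ∘ sucF) m₁ m₂ (s≤s⁻¹ le) (λ c → pre (sucF c) ∘ s≤s) (λ c → suf (sucF c) ∘ s≤s)))
          (count-allFin-head g (pre 0F (s≤s z≤n)))
prefix+suffix≤count (suc n) g zero m₂ le pre suf with m₂ ≤? n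
... | yes m₂≤n = ≤-trans (prefix+suffix≤count n (g ∘ sucF) zero m₂ m₂≤n (λ _ ()) (λ c → suf (sucF c) ∘ s≤s))
                         (count-allFin-tail g)
... | no m₂≰n rewrite ≤-antisym le (≰⇒> m₂≰n) =
  ≤-trans (s≤s (prefix+suffix≤count n (g ∘ sucF) zero n ≤-refl (λ _ ()) (λ c _ → suf (sucF c) (s≤s (≤-trans (n≤1+n n) (m≤n+m (suc n) (toℕ c)))))))
          (count-allFin-head g (suf 0F ≤-refl))

line≤count : ∀ N (g : Fin (suc N) → Bool) m₁ m₂ → m₁ + m₂ ≤ suc N →
  (∀ c → toℕ c < m₁ → g c ≡ true) → (∀ c → N ∸ toℕ c < m₂ → g c ≡ true) →
  m₁ + m₂ ≤ count g (allFin (suc N))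
line≤count N g m₁ m₂ le pre suf = prefix+suffix≤count (suc N) g m₁ m₂ le pre suffix
  where
    suffix : ∀ c → suc N ≤ toℕ c + m₂ → g c ≡ true
    suffix c sN≤c+m₂ = suf c (subst (_≤ m₂) (+-∸-assoc 1 (toℕ≤pred[n] c)) (m≤n+o⇒m∸n≤o (suc N) (toℕ c) sN≤c+m₂))

-- Depth.  In [[N+1]] the depth of z is its distance min(z, N - z) to the
-- nearer end; a line contains exactly 2·depth(z) values shallower than z,
-- the first and the last depth(z) ones.

depth : {N : ℕ} → Fin (suc N) → ℕ
depth {N} z = toℕ z ⊓ (N ∸ toℕ z)

depthSum : {N d : ℕ} → Vertex (suc N) d → ℕ
depthSum w = sum (tabulate (depth ∘ w))

depthSum-≐ : {N d : ℕ} (u v : Vertex (suc N) d) → u ≐ v → depthSum u ≡ depthSum v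
depthSum-≐ u v u≐v = cong sum (tabulate-cong (cong depth ∘ u≐v))

depth+depth≤length : {N : ℕ} (z : Fin (suc N)) → depth z + depth z ≤ suc N
depth+depth≤length {N} z = begin
  depth z + depth z             ≤⟨ +-mono-≤ (m⊓n≤m (toℕ z) _) (m⊓n≤n (toℕ z) _) ⟩
  toℕ z + (N ∸ toℕ z)           ≡⟨ m+[n∸m]≡n (toℕ≤pred[n] z) ⟩
  N                             <⟨ n<1+n N ⟩
  suc N                         ∎
  where open ≤-Reasoning

shallower⇒differs : {N : ℕ} (c z : Fin (suc N)) → depth c < depth z → differs c z ≡ true
shallower⇒differs {N} c z lt = differs-≢ c z λ c≡z → <-irrefl (cong (λ t → t ⊓ (N ∸ t)) c≡z) lt

nbrCount-depthSum : {N d : ℕ} (w : Vertex (suc N) d) (B : VSet (suc N) d) → Extensional B →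
  (∀ w′ → depthSum w′ < depthSum w → B w′ ≡ true) → depthSum w + depthSum w ≤ nbrCount B w
nbrCount-depthSum {N} {zero}  w B B-ext shallower⊆B = z≤n
nbrCount-depthSum {N} {suc d} w B B-ext shallower⊆B = begin
  (m + Mₜ) + (m + Mₜ)                              ≡⟨ solve 2 (λ m Mₜ → (m :+ Mₜ) :+ (m :+ Mₜ) := (Mₜ :+ Mₜ) :+ (m :+ m)) refl m Mₜ ⟩
  (Mₜ + Mₜ) + (m + m)                              ≤⟨ +-mono-≤ inSlice onLine ⟩
  nbrCount (slice B (w 0F)) (tail w) + lineCount B w ≤⟨ nbrCount-split B B-ext w ⟩
  nbrCount B w                                     ∎
  where
    open ≤-Reasoning
    m = depth (w 0F)
    Mₜ = depthSum (tail w)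
    inSlice : Mₜ + Mₜ ≤ nbrCount (slice B (w 0F)) (tail w)
    inSlice = nbrCount-depthSum (tail w) (slice B (w 0F)) (slice-extensional B B-ext (w 0F))
                (λ w′ lt → shallower⊆B (w 0F ◂ w′) (+-monoʳ-< m lt))
    shallower : ∀ c → depth c < m → (differs c (w 0F) ∧ B (c ◂ tail w)) ≡ true
    shallower c lt = ∧-true (shallower⇒differs c (w 0F) lt) (shallower⊆B (c ◂ tail w) (+-monoˡ-< Mₜ lt))
    onLine : m + m ≤ lineCount B w
    onLine = line≤count N _ m m (depth+depth≤length (w 0F))
      (λ c c<m → shallower c (≤-<-trans (m⊓n≤m (toℕ c) _) c<m))
      (λ c N∸c<m → shallower c (≤-<-trans (m⊓n≤n (toℕ c) _) N∸c<m))

reflect : {N : ℕ} → Bool → Fin (suc N) → Fin (suc N)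
reflect b z = if b then opposite z else z

reflectℕ : {N : ℕ} → Bool → Fin (suc N) → ℕ
reflectℕ {N} b z = if b then N ∸ toℕ z else toℕ z

toℕ-reflect : {N : ℕ} (b : Bool) (z : Fin (suc N)) → toℕ (reflect b z) ≡ reflectℕ b z
toℕ-reflect false z = refl
toℕ-reflect true  z = opposite-prop z

reflect-involutive : {N : ℕ} (b : Bool) (z : Fin (suc N)) → (toℕ z ≡ᵇ reflectℕ b (reflect b z)) ≡ true
reflect-involutive {N} b z = T⇒≡true (≡⇒≡ᵇ (toℕ z) _ (sym (involutive b)))
  where
    involutive : ∀ b → reflectℕ b (reflect b z) ≡ toℕ z
    involutive false = refl
    involutive true  = trans (cong (N ∸_) (opposite-prop z)) (m∸[m∸n]≡n (toℕ≤pred[n] z))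

towardsZero : {N : ℕ} → Fin (suc N) → Bool
towardsZero {N} z = (N ∸ toℕ z) <ᵇ toℕ z

toℕ-reflect-depth : {N : ℕ} (z : Fin (suc N)) → toℕ (reflect (towardsZero z) z) ≡ depth z
toℕ-reflect-depth {N} z with (N ∸ toℕ z) <ᵇ toℕ z in past
... | true  = trans (opposite-prop z) (sym (m≥n⇒m⊓n≡n (<⇒≤ (<ᵇ⇒< _ _ (≡true⇒T past)))))
... | false = sym (m≤n⇒m⊓n≡m (≮⇒≥ λ lt → subst T past (<⇒<ᵇ lt)))

inT-≐ : {d : ℕ} (t t′ : Vector Bool d) → t ≐ t′ → inT t ≡ inT t′
inT-≐ {zero}        t t′ t≐t′ = refl
inT-≐ {suc zero}    t t′ t≐t′ = refl
inT-≐ {suc (suc d)} t t′ t≐t′ rewrite t≐t′ 0F | t≐t′ (sucF 0F) = refl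

coordSum-≐ : {n d : ℕ} (p p′ : Vertex n d) → p ≐ p′ → coordSum p ≡ coordSum p′
coordSum-≐ {n} {d} p p′ p≐p′ = cong sum (map-cong (cong toℕ ∘ p≐p′) (allFin d))

coordSum-tabulate : {n d : ℕ} (p : Vertex n d) → coordSum p ≡ sum (tabulate (toℕ ∘ p))
coordSum-tabulate {n} {d} p = cong sum (map-tabulate {n = d} id (toℕ ∘ p))

all-true : {A : Set} (f : A → Bool) → (∀ x → f x ≡ true) → ∀ xs → all f xs ≡ true
all-true f f-true []       = refl
all-true f f-true (x ∷ xs) rewrite f-true x = all-true f f-true xs

any-true : {A : Set} (f : A → Bool) {x : A} {xs : List A} → x ∈ xs → f x ≡ true → any f xs ≡ true
any-true f (here refl) fx rewrite fx = refl
any-true f {xs = y ∷ _} (there x∈xs) fx rewrite any-true f x∈xs fx = ∨-zeroʳ (f y)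

∈-bools : (b : Bool) → b ∈ true ∷ false ∷ []
∈-bools true  = here refl
∈-bools false = there (here refl)

calA-intro : (N d r : ℕ) (u : Vertex (suc N) d) (t : Vector Bool d) →
  inT t ≡ true → coordSum (λ i → reflect (t i) (u i)) ≤ ⌈ r /2⌉ ∸ 1 → calA (suc N) d r u ≡ true
calA-intro N d r u t t∈T p∈A with allVectors-complete (true ∷ false ∷ []) ∈-bools d t | vertices-complete (λ i → reflect (t i) (u i))
... | t′ , t′∈ , t′≐t | p′ , p′∈ , p′≐p =
  any-true _ t′∈ (∧-true (trans (inT-≐ t′ t t′≐t) t∈T) (any-true _ p′∈ (∧-true p′∈A u-reflects)))
  where
    p′∈A : Ard (suc N) d r p′ ≡ true
    p′∈A = T⇒≡true (≤⇒≤ᵇ (subst (_≤ ⌈ r /2⌉ ∸ 1) (sym (coordSum-≐ p′ _ p′≐p)) p∈A))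
    u-reflects : reflects t′ p′ u ≡ true
    u-reflects = all-true _ (λ i → subst (λ q → (toℕ (u i) ≡ᵇ q) ≡ true)
      (cong₂ reflectℕ (sym (t′≐t i)) (sym (p′≐p i)))
      (reflect-involutive (t i) (u i))) (allFin d)

-- The form used below: reflect the first two coordinates both or neither
-- (as T demands) and every further coordinate towards 0.
calA-member : (N d r : ℕ) (s : Bool) (u : Vertex (suc N) (suc (suc d))) →
  reflectℕ s (u 0F) + (reflectℕ s (u (sucF 0F)) + depthSum (tail (tail u))) ≤ ⌈ r /2⌉ ∸ 1 →
  calA (suc N) (suc (suc d)) r u ≡ true
calA-member N d r s u small = calA-intro N (suc (suc d)) r u t t∈T sum≤
  where
    t : Vector Bool (suc (suc d))
    t 0F               = s
    t (sucF 0F)        = s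
    t (sucF (sucF j))  = towardsZero (u (sucF (sucF j)))
    t∈T : inT t ≡ true
    t∈T = T⇒≡true (fromWitness {a? = s Bool.≟ s} refl)
    sum≤ : coordSum (λ i → reflect (t i) (u i)) ≤ ⌈ r /2⌉ ∸ 1
    sum≤ = subst (_≤ ⌈ r /2⌉ ∸ 1) (sym (trans (coordSum-tabulate (λ i → reflect (t i) (u i)))
      (cong₂ _+_ (toℕ-reflect s (u 0F)) (cong₂ _+_ (toℕ-reflect s (u (sucF 0F)))
        (cong sum (tabulate-cong (toℕ-reflect-depth ∘ u ∘ sucF ∘ sucF))))))) small

calA-extensional : (n d r : ℕ) → Extensional (calA n d r)
calA-extensional n d r u u′ u≐u′ = cong or (map-cong (λ t → cong (inT t ∧_)
  (cong or (map-cong (λ p → cong (Ard n d r p ∧_)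
    (cong and (map-cong (λ i → cong (λ z → toℕ z ≡ᵇ _) (u≐u′ i)) (allFin d)))) (vertices n d))))
  (allVectors (true ∷ false ∷ []) d))

nbrCount-mono : {n d : ℕ} (B B′ : VSet n d) → (∀ u → B u ≡ true → B′ u ≡ true) →
  ∀ v → nbrCount B v ≤ nbrCount B′ v
nbrCount-mono {n} {d} B B′ B⊆B′ v = count-mono _ _ adj∧ (vertices n d)
  where
    adj∧ : ∀ u → (adj v u ∧ B u) ≡ true → (adj v u ∧ B′ u) ≡ true
    adj∧ u e with adj v u
    ... | true  = B⊆B′ u e
    ... | false = e

active-suc : {n d : ℕ} (r : ℕ) (A : VSet n d) (i : ℕ) (u : Vertex n d) →
  active r A i u ≡ true → active r A (suc i) u ≡ true
active-suc r A i u e = cong (_∨ (r ≤ᵇ nbrCount (active r A i) u)) e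

active-mono : {n d : ℕ} (r : ℕ) (A : VSet n d) {i j : ℕ} (u : Vertex n d) →
  i ≤ j → active r A i u ≡ true → active r A j u ≡ true
active-mono r A {i} {j} u i≤j e with ≤⇒≤′ i≤j
... | ≤′-refl        = e
... | ≤′-step {k} i≤′k = active-suc r A k u (active-mono r A u (≤′⇒≤ i≤′k) e)

active-threshold : {n d : ℕ} (r : ℕ) (A : VSet n d) (i : ℕ) (v : Vertex n d) →
  r ≤ nbrCount (active r A i) v → active r A (suc i) v ≡ true
active-threshold r A i v r≤ = trans (cong (active r A i v ∨_) (T⇒≡true (≤⇒≤ᵇ r≤))) (∨-zeroʳ _)

-- Arithmetic for adding up the neighbour counts.  K = ⌈r/2⌉ - 1 + 1 is
-- the threshold of A_r^d: a vertex with coordinate sum below K lies in it.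

r≤K+K : ∀ r → r ≤ suc (⌈ r /2⌉ ∸ 1) + suc (⌈ r /2⌉ ∸ 1)
r≤K+K r = begin
  r                         ≡⟨ sym (⌊n/2⌋+⌈n/2⌉≡n r) ⟩
  ⌊ r /2⌋ + ⌈ r /2⌉         ≤⟨ +-monoˡ-≤ ⌈ r /2⌉ (⌊n/2⌋≤⌈n/2⌉ r) ⟩
  ⌈ r /2⌉ + ⌈ r /2⌉         ≤⟨ +-mono-≤ (m≤n+m∸n ⌈ r /2⌉ 1) (m≤n+m∸n ⌈ r /2⌉ 1) ⟩
  suc (⌈ r /2⌉ ∸ 1) + suc (⌈ r /2⌉ ∸ 1) ∎
  where open ≤-Reasoning

below-threshold : ∀ {c K z} → c < K ∸ z → c + z < K
below-threshold {c} {K} {z} c<K∸z with z ≤? K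
... | yes z≤K = subst (c + z <_) (m∸n+n≡m z≤K) (+-monoˡ-< z c<K∸z)
... | no  z≰K = ⊥-elim (n≮0 (subst (c <_) (m≤n⇒m∸n≡0 (<⇒≤ (≰⇒> z≰K))) c<K∸z))

twoLines : ∀ {N r K M} p q → r ≤ N → r ≤ K + K → K + K ≤ (M + M) + (p + q) →
  r ≤ (M + M) + (N ⊓ p + N ⊓ q)
twoLines {N} {r} {K} {M} p q r≤N r≤2K 2K≤ with ≤-total N p | ≤-total N q
... | inj₁ N≤p | _ rewrite m≤n⇒m⊓n≡m N≤p = ≤-trans r≤N (≤-trans (m≤m+n N _) (m≤n+m _ (M + M)))
... | inj₂ _ | inj₁ N≤q rewrite m≤n⇒m⊓n≡m N≤q = ≤-trans r≤N (≤-trans (m≤n+m N _) (m≤n+m _ (M + M)))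
... | inj₂ p≤N | inj₂ q≤N rewrite m≥n⇒m⊓n≡n p≤N | m≥n⇒m⊓n≡n q≤N = ≤-trans r≤2K 2K≤

module Potential (N d r : ℕ) (r≤N : r ≤ N) where

  𝒜 : VSet (suc N) (suc (suc d))
  𝒜 = calA (suc N) (suc (suc d)) r

  K : ℕ
  K = suc (⌈ r /2⌉ ∸ 1)

  potential : Vertex (suc N) (suc (suc d)) → ℕ
  potential v = (N ∸ toℕ (v 0F)) + (toℕ (v (sucF 0F)) + depthSum (tail (tail v)))

  module _ (v : Vertex (suc N) (suc (suc d))) (C : VSet (suc N) (suc (suc d))) (C-ext : Extensional C)
           (𝒜⊆C : ∀ u → 𝒜 u ≡ true → C u ≡ true)
           (lower⊆C : ∀ u → potential u < potential v → C u ≡ true) where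

    x₀ x₁ : Fin (suc N)
    x₀ = v 0F
    x₁ = v (sucF 0F)
    w : Vertex (suc N) d
    w = tail (tail v)
    a y M : ℕ
    a = N ∸ toℕ x₀
    y = toℕ x₁
    M = depthSum w
    -- first coordinates below Q give vertices of A_r^d itself
    Q = K ∸ (y + M)
    -- second coordinates within Q′ of N give vertices of A_r^d(1,1,…)
    Q′ = K ∸ (a + M)

    -- Line in direction 0: values above x₀ lower the potential, values below Q are in 𝒜.
    rowBound : N ⊓ (Q + a) ≤ lineCount C v
    rowBound = subst (_≤ lineCount C v) row-size (line≤count N _ (toℕ x₀ ⊓ Q) a fits low high)
      where
        row-size : toℕ x₀ ⊓ Q + a ≡ N ⊓ (Q + a)
        row-size = trans (+-distribʳ-⊓ a (toℕ x₀) Q) (cong (_⊓ (Q + a)) (m+[n∸m]≡n (toℕ≤pred[n] x₀)))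
        fits : toℕ x₀ ⊓ Q + a ≤ suc N
        fits = ≤-trans (≤-reflexive row-size) (≤-trans (m⊓n≤m N _) (n≤1+n N))
        low : ∀ c → toℕ c < toℕ x₀ ⊓ Q → (differs c x₀ ∧ C (c ◂ tail v)) ≡ true
        low c c< = ∧-true (differs-≢ c x₀ (<⇒≢ (<-≤-trans c< (m⊓n≤m _ Q))))
          (𝒜⊆C _ (calA-member N d r false (c ◂ tail v) (s≤s⁻¹ (below-threshold (<-≤-trans c< (m⊓n≤n _ Q))))))
        high : ∀ c → N ∸ toℕ c < a → (differs c x₀ ∧ C (c ◂ tail v)) ≡ true
        high c N∸c<a = ∧-true (differs-≢ c x₀ (>⇒≢ (∸-cancelʳ-< N∸c<a)))
          (lower⊆C _ (+-monoˡ-< (y + M) N∸c<a))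

    -- Line in direction 1: values below x₁ lower the potential, values within Q′ of N are in 𝒜.
    columnBound : N ⊓ (y + Q′) ≤ lineCount (slice C x₀) (tail v)
    columnBound = subst (_≤ lineCount (slice C x₀) (tail v)) column-size
                        (line≤count N _ y ((N ∸ y) ⊓ Q′) fits low high)
      where
        column-size : y + (N ∸ y) ⊓ Q′ ≡ N ⊓ (y + Q′)
        column-size = trans (+-distribˡ-⊓ y (N ∸ y) Q′) (cong (_⊓ (y + Q′)) (m+[n∸m]≡n (toℕ≤pred[n] x₁)))
        fits : y + (N ∸ y) ⊓ Q′ ≤ suc N
        fits = ≤-trans (≤-reflexive column-size) (≤-trans (m⊓n≤m N _) (n≤1+n N))
        low : ∀ c → toℕ c < y → (differs c x₁ ∧ C (x₀ ◂ (c ◂ w))) ≡ true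
        low c c<y = ∧-true (differs-≢ c x₁ (<⇒≢ c<y)) (lower⊆C _ (+-monoʳ-< a (+-monoˡ-< M c<y)))
        reflected-small : ∀ c → N ∸ toℕ c < Q′ → a + ((N ∸ toℕ c) + M) ≤ ⌈ r /2⌉ ∸ 1
        reflected-small c lt = s≤s⁻¹ (subst (_< K)
          (solve 3 (λ c a M → c :+ (a :+ M) := a :+ (c :+ M)) refl (N ∸ toℕ c) a M)
          (below-threshold lt))
        high : ∀ c → N ∸ toℕ c < (N ∸ y) ⊓ Q′ → (differs c x₁ ∧ C (x₀ ◂ (c ◂ w))) ≡ true
        high c lt = ∧-true (differs-≢ c x₁ (>⇒≢ (∸-cancelʳ-< (<-≤-trans lt (m⊓n≤m _ Q′)))))
          (𝒜⊆C _ (calA-member N d r true (x₀ ◂ (c ◂ w)) (reflected-small c (<-≤-trans lt (m⊓n≤n _ Q′)))))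

    -- The remaining directions: moving a coordinate to a shallower value lowers the potential.
    restBound : M + M ≤ nbrCount (slice (slice C x₀) x₁) w
    restBound = nbrCount-depthSum w _
      (slice-extensional _ (slice-extensional C C-ext x₀) x₁)
      (λ w′ lt → lower⊆C (x₀ ◂ (x₁ ◂ w′)) (+-monoʳ-< a (+-monoʳ-< y lt)))

    enoughNeighbours : r ≤ nbrCount C v
    enoughNeighbours = begin
      r                                                   ≤⟨ twoLines {N} {r} {K} {M} (y + Q′) (Q + a) r≤N (r≤K+K r) 2K≤ ⟩
      (M + M) + (N ⊓ (y + Q′) + N ⊓ (Q + a))              ≤⟨ +-mono-≤ restBound (+-mono-≤ columnBound rowBound) ⟩
      nbrCount (slice (slice C x₀) x₁) w + (lineCount (slice C x₀) (tail v) + lineCount C v)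
                                                          ≡⟨ sym (+-assoc (nbrCount (slice (slice C x₀) x₁) w) (lineCount (slice C x₀) (tail v)) (lineCount C v)) ⟩
      (nbrCount (slice (slice C x₀) x₁) w + lineCount (slice C x₀) (tail v)) + lineCount C v
                                                          ≤⟨ +-monoˡ-≤ (lineCount C v) (nbrCount-split (slice C x₀) (slice-extensional C C-ext x₀) (tail v)) ⟩
      nbrCount (slice C x₀) (tail v) + lineCount C v      ≤⟨ nbrCount-split C C-ext v ⟩
      nbrCount C v                                        ∎
      where
        open ≤-Reasoning
        2K≤ : K + K ≤ (M + M) + ((y + Q′) + (Q + a))
        2K≤ = ≤-trans (+-mono-≤ (m≤n+m∸n K (y + M)) (m≤n+m∸n K (a + M))) (≤-reflexive
          (solve 5 (λ y M Q a Q′ → (y :+ M :+ Q) :+ (a :+ M :+ Q′) := (M :+ M) :+ ((y :+ Q′) :+ (Q :+ a))) refl y M Q a Q′))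

  -- If all vertices of smaller potential are active in time, so is v:
  -- they and 𝒜 are active at time μ(v) and provide r neighbours.
  activeStep : ∀ v → (∀ u → potential u < potential v → active r 𝒜 (suc (potential u)) u ≡ true) →
    active r 𝒜 (suc (potential v)) v ≡ true
  activeStep v lower-active = active-threshold r 𝒜 (potential v) v
    (≤-trans (enoughNeighbours v C C-ext 𝒜⊆C lower⊆C) (nbrCount-mono C (active r 𝒜 (potential v)) C⊆active v))
    where
      C : VSet (suc N) (suc (suc d))
      C u = (potential u <ᵇ potential v) ∨ 𝒜 u
      C-ext : Extensional C
      C-ext u u′ u≐u′ = cong₂ _∨_ (cong (_<ᵇ potential v) (cong₂ _+_ (cong (λ z → N ∸ toℕ z) (u≐u′ 0F))
          (cong₂ _+_ (cong toℕ (u≐u′ (sucF 0F))) (depthSum-≐ _ _ (u≐u′ ∘ sucF ∘ sucF)))))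
        (calA-extensional (suc N) (suc (suc d)) r u u′ u≐u′)
      𝒜⊆C : ∀ u → 𝒜 u ≡ true → C u ≡ true
      𝒜⊆C u e = trans (cong ((potential u <ᵇ potential v) ∨_) e) (∨-zeroʳ _)
      lower⊆C : ∀ u → potential u < potential v → C u ≡ true
      lower⊆C u lt = cong (_∨ 𝒜 u) (T⇒≡true (<⇒<ᵇ lt))
      C⊆active : ∀ u → C u ≡ true → active r 𝒜 (potential v) u ≡ true
      C⊆active u e with ∨-true (potential u <ᵇ potential v) (𝒜 u) e
      ... | inj₁ lt = active-mono r 𝒜 {suc (potential u)} {potential v} u μu<μv (lower-active u μu<μv)
        where μu<μv = <ᵇ⇒< (potential u) (potential v) (≡true⇒T lt)
      ... | inj₂ u∈𝒜 = active-mono r 𝒜 {0} {potential v} u z≤n u∈𝒜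

  activeBy : ∀ b v → potential v < b → active r 𝒜 (suc (potential v)) v ≡ true
  activeBy (suc b) v μv<b = activeStep v λ u μu<μv → activeBy b u (≤-trans μu<μv (s≤s⁻¹ μv<b))

  percolates : Percolates (suc N) (suc (suc d)) r 𝒜
  percolates v = suc (potential v) , activeBy (suc (potential v)) v ≤-refl

lemma4p1 : (n r d : ℕ) → 1 ≤ n → 1 ≤ r → 1 ≤ d → r + 1 ≤ n → 2 ≤ d →
    Percolates n d r (calA n d r)
lemma4p1 (suc N) r (suc (suc d)) _ _ _ r+1≤n (s≤s (s≤s z≤n)) =
  Potential.percolates N d r (s≤s⁻¹ (subst (_≤ suc N) (+-comm r 1) r+1≤n))
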